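{- Let $\Omega=(S,\Sigma,\Pi)$ be a many-sorted signature, $\mathcal{S}_0$ a theory (set of sentences) over $\Omega$, $\mathcal{S}=\mathcal{S}_0^{\vdash}$ its ground deductive closure, and $\mathcal{I}=\mathcal{I}_{\mathcal{S}}$ the initial model of $\mathcal{S}$. Let $\varphi$ be a sentence of the form $(Q_1 x_1:s_1)\cdots(Q_k x_k:s_k)\bigvee_{i=1}^m\bigwedge_{j=1}^{n_i} L_{ij}$ (each $L_{ij}$ a literal, $x_1,\ldots,x_k$ the variables occurring in the literals, of sorts $s_1,\ldots,s_k$, $Q_q\in\{\forall,\exists\}$). Let $\mathcal{A}$ be a model of $\mathcal{S}_0$, with $h:\mathcal{I}\to\mathcal{A}$ the unique homomorphism, such that (a) for every $q$ with $1\le q\le k$ and $Q_q=\forall$, $h_{s_q}$ is surjective; and (b) for every negative literal $L_{ij}=\neg P(t_1,\ldots,t_n)$ of $\varphi$, with $P\in\Pi_w$, and every substitution $\sigma$ of ground terms for variables, if $h(\sigma(t_1),\ldots,\sigma(t_n))\in P^{\mathcal{A}}$ then $(\sigma(t_1),\ldots,\sigma(t_n))\in P^{\mathcal{I}}$. If $\mathcal{A}\models\neg\varphi$, then $\mathcal{I}_{\mathcal{S}}\models\neg\varphi$.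
   Context: Many-sorted first-order logic with sorted signatures $\Omega=(S,\Sigma,\Pi)$, structures and homomorphisms as usual (the identity predicate, if present, is interpreted as identity; homomorphisms commute with function symbols and map tuples in $P^{\mathcal{A}}$ into $P^{\mathcal{A}'}$). The ground deductive closure $\mathcal{S}_0^{\vdash}$ of a theory $\mathcal{S}_0$ is the set of ground atoms $P(t_1,\ldots,t_n)$ ($t_i$ ground terms) such that $\mathcal{S}_0\vdash P(t_1,\ldots,t_n)$. The initial model $\mathcal{I}_{\mathcal{S}}$ of a set $\mathcal{S}$ of ground atoms has as carrier of sort $s$ the ground terms of sort $s$ modulo the least congruence $\sim$ generated by the ground equations in $\mathcal{S}$, syntactic function interpretation, and $P^{\mathcal{I}}$ the tuples of classes containing some $(t_1,\ldots,t_n)$ with $P(t_1,\ldots,t_n)\in\mathcal{S}$. For a model $\mathcal{A}$ of $\mathcal{S}$, the unique homomorphism $h:\mathcal{I}_{\mathcal{S}}\to\mathcal{A}$ maps the class of a ground term to its value in $\mathcal{A}$. A literal is an atom (positive) or a negated atom (negative); $\sigma(t)$ for ground substitutions is regarded as an element of $\mathcal{I}$. -}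

module Defs where

open import Level using (Level; _⊔_; Lift; lift; 0ℓ) renaming (suc to lsuc)
open import Data.Bool using (Bool; T)
open import Data.Empty using (⊥)
open import Data.Unit using (⊤)
open import Data.Product using (Σ; _×_; _,_)
open import Data.Sum using (_⊎_)
open import Data.List using (List; []; _∷_)
open import Data.List.Membership.Propositional using (_∈_)
open import Data.List.Relation.Unary.Any using (here; there)
open import Relation.Binary.PropositionalEquality using (refl)
open import Relation.Binary.Structures using (IsEquivalence)

-- Fun w s  = Σ_{w,s} (function symbols of arity w and result sort s),
-- Pred w   = Π_w     (predicate symbols of arity w),
-- hasId    = whether the identity predicate (on every sort) is present.

record Signature : Set₁ where
  field
    Sort  : Set
    Fun   : List Sort → Sort → Set
    Pred  : List Sort → Set
    hasId : Bool

module _ (Ω : Signature) where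
  open Signature Ω

  data Term (Γ : List Sort) : Sort → Set
  data Terms (Γ : List Sort) : List Sort → Set

  data Term Γ where
    var : ∀ {s} → s ∈ Γ → Term Γ s
    app : ∀ {w s} → Fun w s → Terms Γ w → Term Γ s

  data Terms Γ where
    []  : Terms Γ []
    _∷_ : ∀ {s w} → Term Γ s → Terms Γ w → Terms Γ (s ∷ w)

  data Atom (Γ : List Sort) : Set where
    pred  : ∀ {w} → Pred w → Terms Γ w → Atom Γ
    ident : T hasId → ∀ {s} → Term Γ s → Term Γ s → Atom Γ

  data Formula (Γ : List Sort) : Set where
    atom          : Atom Γ → Formula Γ
    ⊤' ⊥'         : Formula Γ
    ¬'_           : Formula Γ → Formula Γ
    _∧'_ _∨'_ _⇒'_ : Formula Γ → Formula Γ → Formula Γ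
    ∀' ∃'         : (s : Sort) → Formula (s ∷ Γ) → Formula Γ

  Sentence : Set
  Sentence = Formula []

  Theory : Set₁
  Theory = Sentence → Set

  -- Structures.  Since quotients are not available, carriers are setoids;
  -- the identity predicate is interpreted as the setoid equality.

  Tuple : ∀ {a} → (Sort → Set a) → List Sort → Set a
  Tuple C []      = Lift _ ⊤
  Tuple C (s ∷ w) = C s × Tuple C w

  Pointwise : ∀ {a ℓ} {C : Sort → Set a} → (∀ {s} → C s → C s → Set ℓ) →
              ∀ {w} → Tuple C w → Tuple C w → Set ℓ
  Pointwise R {[]}    _        _        = Lift _ ⊤
  Pointwise R {s ∷ w} (x , xs) (y , ys) = R x y × Pointwise R xs ys

  mapTuple : ∀ {a b} {C : Sort → Set a} {D : Sort → Set b} →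
             (∀ {s} → C s → D s) → ∀ {w} → Tuple C w → Tuple D w
  mapTuple f {[]}    _        = lift _
  mapTuple f {s ∷ w} (x , xs) = f x , mapTuple f xs

  record Structure (a ℓ : Level) : Set (lsuc (a ⊔ ℓ)) where
    field
      Car      : Sort → Set a
      _≈_      : ∀ {s} → Car s → Car s → Set ℓ
      ≈-equiv  : ∀ s → IsEquivalence (_≈_ {s})
      fun      : ∀ {w s} → Fun w s → Tuple Car w → Car s
      fun-cong : ∀ {w s} (f : Fun w s) {xs ys} →
                 Pointwise _≈_ xs ys → fun f xs ≈ fun f ys
      rel      : ∀ {w} → Pred w → Tuple Car w → Set ℓ
      rel-resp : ∀ {w} (P : Pred w) {xs ys} →
                 Pointwise _≈_ xs ys → rel P xs → rel P ys

  module _ {a ℓ : Level} (A : Structure a ℓ) where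
    open Structure A

    Env : List Sort → Set a
    Env Γ = ∀ {s} → s ∈ Γ → Car s

    extend : ∀ {Γ s} → Env Γ → Car s → Env (s ∷ Γ)
    extend ρ x (here refl) = x
    extend ρ x (there i)   = ρ i

    emptyEnv : Env []
    emptyEnv ()

    eval  : ∀ {Γ s} → Term Γ s → Env Γ → Car s
    evals : ∀ {Γ w} → Terms Γ w → Env Γ → Tuple Car w
    eval (var i)    ρ = ρ i
    eval (app f ts) ρ = fun f (evals ts ρ)
    evals []       ρ = lift _
    evals (t ∷ ts) ρ = eval t ρ , evals ts ρ

    SatAtom : ∀ {Γ} → Atom Γ → Env Γ → Set ℓ
    SatAtom (pred P ts)   ρ = rel P (evals ts ρ)
    SatAtom (ident _ t u) ρ = eval t ρ ≈ eval u ρ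

    Sat : ∀ {Γ} → Formula Γ → Env Γ → Set (a ⊔ ℓ)
    Sat (atom α)  ρ = Lift a (SatAtom α ρ)
    Sat ⊤'        ρ = Lift _ ⊤
    Sat ⊥'        ρ = Lift _ ⊥
    Sat (¬' φ)    ρ = Sat φ ρ → ⊥
    Sat (φ ∧' ψ)  ρ = Sat φ ρ × Sat ψ ρ
    Sat (φ ∨' ψ)  ρ = Sat φ ρ ⊎ Sat ψ ρ
    Sat (φ ⇒' ψ)  ρ = Sat φ ρ → Sat ψ ρ
    Sat (∀' s φ)  ρ = (x : Car s) → Sat φ (extend ρ x)
    Sat (∃' s φ)  ρ = Σ (Car s) λ x → Sat φ (extend ρ x)

    _⊨_ : Sentence → Set (a ⊔ ℓ)
    _⊨_ φ = Sat φ emptyEnv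

    IsModel : Theory → Set (a ⊔ ℓ)
    IsModel T = ∀ φ → T φ → _⊨_ φ

  -- Ground deductive closure S₀^⊢ (entailment taken semantically).

  GroundAtom : Set
  GroundAtom = Atom []

  Closure : Theory → GroundAtom → Set₁
  Closure S₀ α = (B : Structure 0ℓ 0ℓ) → IsModel B S₀ → B ⊨ atom α

  GTerm : Sort → Set
  GTerm = Term []

  module Congruence (S : GroundAtom → Set₁) where
    data _~_ : ∀ {s} → GTerm s → GTerm s → Set₁
    data _~*_ : ∀ {w} → Terms [] w → Terms [] w → Set₁

    data _~_ where
      ~gen   : ∀ {s} {t u : GTerm s} (p : T hasId) → S (ident p t u) → t ~ u
      ~refl  : ∀ {s} {t : GTerm s} → t ~ t
      ~sym   : ∀ {s} {t u : GTerm s} → t ~ u → u ~ t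
      ~trans : ∀ {s} {t u v : GTerm s} → t ~ u → u ~ v → t ~ v
      ~cong  : ∀ {w s} (f : Fun w s) {ts us} → ts ~* us → app f ts ~ app f us

    data _~*_ where
      []  : [] ~* []
      _∷_ : ∀ {s w} {t u : GTerm s} {ts us : Terms [] w} →
            t ~ u → ts ~* us → (t ∷ ts) ~* (u ∷ us)

    fromTuple : ∀ {w} → Tuple GTerm w → Terms [] w
    fromTuple {[]}    _        = []
    fromTuple {s ∷ w} (t , ts) = t ∷ fromTuple ts

    fromPointwise : ∀ {w} {xs ys : Tuple GTerm w} →
                    Pointwise _~_ xs ys → fromTuple xs ~* fromTuple ys
    fromPointwise {[]}    _        = []
    fromPointwise {s ∷ w} (p , ps) = p ∷ fromPointwise ps

    ~*-trans : ∀ {w} {ts us vs : Terms [] w} → ts ~* us → us ~* vs → ts ~* vs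
    ~*-trans []       []       = []
    ~*-trans (p ∷ ps) (q ∷ qs) = ~trans p q ∷ ~*-trans ps qs

  Initial : (GroundAtom → Set₁) → Structure 0ℓ (lsuc 0ℓ)
  Initial S = record
    { Car      = GTerm
    ; _≈_      = _~_
    ; ≈-equiv  = λ s → record { refl = ~refl ; sym = ~sym ; trans = ~trans }
    ; fun      = λ f ts → app f (fromTuple ts)
    ; fun-cong = λ f ps → ~cong f (fromPointwise ps)
    ; rel      = λ P xs → Σ (Terms [] _) λ ts → (ts ~* fromTuple xs) × S (pred P ts)
    ; rel-resp = λ P ps → λ { (ts , q , s) → ts , ~*-trans q (fromPointwise ps) , s }
    }
    where open Congruence S

  record Hom {a ℓ b m} (A : Structure a ℓ) (B : Structure b m) : Set (a ⊔ ℓ ⊔ b ⊔ m) where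
    private
      module A = Structure A
      module B = Structure B
    field
      h     : ∀ {s} → A.Car s → B.Car s
      h-cong : ∀ {s} {x y : A.Car s} → x A.≈ y → h x B.≈ h y
      h-fun  : ∀ {w s} (f : Fun w s) (xs : Tuple A.Car w) →
               h (A.fun f xs) B.≈ B.fun f (mapTuple h xs)
      h-rel  : ∀ {w} (P : Pred w) (xs : Tuple A.Car w) →
               A.rel P xs → B.rel P (mapTuple h xs)

  SurjectiveAt : ∀ {a ℓ b m} {A : Structure a ℓ} {B : Structure b m} →
                 Hom A B → Sort → Set (a ⊔ b ⊔ m)
  SurjectiveAt {A = A} {B} H s =
    (y : Structure.Car B s) → Σ (Structure.Car A s) λ x → Structure._≈_ B (Hom.h H x) y

  data Quant : Set where
    all ex : Quant

  -- Prefix Γ: a quantifier prefix binding the variables of Γ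
  -- (the last quantifier added is the innermost one, binding the head of Γ).
  data Prefix : List Sort → Set where
    []  : Prefix []
    _▹_ : ∀ {Γ} → Prefix Γ → (Qs : Quant × Sort) →
          Prefix (Data.Product.proj₂ Qs ∷ Γ)

  univSorts : ∀ {Γ} → Prefix Γ → List Sort
  univSorts []               = []
  univSorts (p ▹ (all , s))  = s ∷ univSorts p
  univSorts (p ▹ (ex , s))   = univSorts p

  data Literal (Γ : List Sort) : Set where
    pos neg : Atom Γ → Literal Γ

  Matrix : List Sort → Set
  Matrix Γ = List (List (Literal Γ))

  litFormula : ∀ {Γ} → Literal Γ → Formula Γ
  litFormula (pos α) = atom α
  litFormula (neg α) = ¬' atom α

  conjF : ∀ {Γ} → List (Literal Γ) → Formula Γ
  conjF []       = ⊤'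
  conjF (L ∷ []) = litFormula L
  conjF (L ∷ Ls) = litFormula L ∧' conjF Ls

  disjF : ∀ {Γ} → Matrix Γ → Formula Γ
  disjF []       = ⊥'
  disjF (c ∷ []) = conjF c
  disjF (c ∷ cs) = conjF c ∨' disjF cs

  close : ∀ {Γ} → Prefix Γ → Formula Γ → Sentence
  close []             φ = φ
  close (p ▹ (all , s)) φ = close p (∀' s φ)
  close (p ▹ (ex , s))  φ = close p (∃' s φ)

  prenexDNF : ∀ {Γ} → Prefix Γ → Matrix Γ → Sentence
  prenexDNF p M = close p (disjF M)

  Reflects : ∀ {a ℓ b m} {I : Structure a ℓ} {A : Structure b m} →
             Hom I A → ∀ {Γ} → Atom Γ → Set (a ⊔ ℓ ⊔ m)
  Reflects {I = I} {A} H (pred P ts) =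
    (σ : Env I _) → Structure.rel A P (mapTuple (Hom.h H) (evals I ts σ)) →
                    Structure.rel I P (evals I ts σ)
  Reflects {I = I} {A} H (ident _ t u) =
    (σ : Env I _) → Structure._≈_ A (Hom.h H (eval I t σ)) (Hom.h H (eval I u σ)) →
                    Structure._≈_ I (eval I t σ) (eval I u σ)

{-# OPTIONS --safe #-}
-- A homomorphism h : B → A carries satisfaction of a prenex DNF sentence φ
-- from B to A, as soon as h reflects the atoms occurring negatively in φ and is
-- surjective on the universally quantified sorts: positive atoms are preserved
-- by every homomorphism, existential witnesses are transported along h, and by
-- surjectivity every element of A met by a universal quantifier is the image
-- of one in B.  With B the initial model this is the contrapositive of the
-- corollary.
module Submission where

open import Defs
open import Level using (Level; lift)
open import Data.List using (List; []; _∷_)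
open import Data.List.Membership.Propositional using (_∈_)
open import Data.List.Relation.Unary.Any using (here; there)
open import Data.Product using (_,_)
open import Data.Sum using (inj₁; inj₂)
open import Relation.Binary.PropositionalEquality using (refl)
open import Relation.Binary.Structures using (IsEquivalence)

module _ {Ω : Signature} where
  open Signature Ω

  Pointwise-sym : ∀ {c r} {C : Sort → Set c} {R : ∀ {s} → C s → C s → Set r} →
                  (∀ {s} {x y : C s} → R x y → R y x) →
                  ∀ {w} {xs ys : Tuple Ω C w} →
                  Pointwise Ω R xs ys → Pointwise Ω R ys xs
  Pointwise-sym sym {[]}    _        = lift _
  Pointwise-sym sym {s ∷ w} (p , ps) = sym p , Pointwise-sym sym ps

module HomPreservation {a ℓ b m : Level} {Ω : Signature}
  {B : Structure Ω b m} {A : Structure Ω a ℓ} (H : Hom Ω B A) where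
  open Signature Ω
  private
    module A = Structure A
    module B = Structure B
    module ≈A {s} = IsEquivalence (A.≈-equiv s)
  open Hom H

  EnvOver : ∀ {Γ} → Env Ω B Γ → Env Ω A Γ → Set ℓ
  EnvOver {Γ} σ ρ = ∀ {s} (i : s ∈ Γ) → h (σ i) A.≈ ρ i

  extend-over : ∀ {Γ s} {σ : Env Ω B Γ} {ρ : Env Ω A Γ} {x : B.Car s} {y : A.Car s} →
                EnvOver σ ρ → h x A.≈ y →
                EnvOver (extend Ω B {s = s} σ x) (extend Ω A ρ y)
  extend-over σρ xy (here refl) = xy
  extend-over σρ xy (there i)   = σρ i

  eval-hom  : ∀ {Γ s} (t : Term Ω Γ s) {σ : Env Ω B Γ} {ρ : Env Ω A Γ} →
              EnvOver σ ρ → h (eval Ω B t σ) A.≈ eval Ω A t ρ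
  evals-hom : ∀ {Γ w} (ts : Terms Ω Γ w) {σ : Env Ω B Γ} {ρ : Env Ω A Γ} →
              EnvOver σ ρ →
              Pointwise Ω A._≈_ (mapTuple Ω h (evals Ω B ts σ)) (evals Ω A ts ρ)
  eval-hom (var i)        σρ = σρ i
  eval-hom (app f ts) {σ} σρ =
    ≈A.trans (h-fun f (evals Ω B ts σ)) (A.fun-cong f (evals-hom ts σρ))
  evals-hom []       σρ = lift _
  evals-hom (t ∷ ts) σρ = eval-hom t σρ , evals-hom ts σρ

  Preserved : ∀ {Γ} → Formula Ω Γ → Set _
  Preserved {Γ} φ = ∀ {σ : Env Ω B Γ} {ρ : Env Ω A Γ} →
                    EnvOver σ ρ → Sat Ω B φ σ → Sat Ω A φ ρ

  atom-preserved : ∀ {Γ} (α : Atom Ω Γ) → Preserved (atom α)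
  atom-preserved (pred P ts) {σ} σρ (lift Pσ) =
    lift (A.rel-resp P (evals-hom ts σρ) (h-rel P (evals Ω B ts σ) Pσ))
  atom-preserved (ident _ t u) σρ (lift t≈u) =
    lift (≈A.trans (≈A.sym (eval-hom t σρ)) (≈A.trans (h-cong t≈u) (eval-hom u σρ)))

  negAtom-preserved : ∀ {Γ} (α : Atom Ω Γ) → Reflects Ω H α → Preserved (¬' atom α)
  negAtom-preserved (pred P ts) reflects {σ} σρ ¬Pσ (lift Pρ) =
    ¬Pσ (lift (reflects σ (A.rel-resp P (Pointwise-sym ≈A.sym (evals-hom ts σρ)) Pρ)))
  negAtom-preserved (ident _ t u) reflects {σ} σρ ¬t≈u (lift t≈u) =
    ¬t≈u (lift (reflects σ
      (≈A.trans (eval-hom t σρ) (≈A.trans t≈u (≈A.sym (eval-hom u σρ))))))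

  NegativesReflected : ∀ {Γ} → List (Literal Ω Γ) → Set _
  NegativesReflected c = ∀ {α} → neg α ∈ c → Reflects Ω H α

  literal-preserved : ∀ {Γ} (L : Literal Ω Γ) → NegativesReflected (L ∷ []) →
                      Preserved (litFormula Ω L)
  literal-preserved (pos α) _         = atom-preserved α
  literal-preserved (neg α) reflected = negAtom-preserved α (reflected (here refl))

  conj-preserved : ∀ {Γ} (c : List (Literal Ω Γ)) → NegativesReflected c →
                   Preserved (conjF Ω c)
  conj-preserved []            _         _  _ = lift _
  conj-preserved (L ∷ [])      reflected    = literal-preserved L reflected
  conj-preserved (L ∷ L′ ∷ Ls) reflected σρ (satL , satLs) =
    literal-preserved L (λ { (here eq) → reflected (here eq) }) σρ satL ,
    conj-preserved (L′ ∷ Ls) (λ i → reflected (there i)) σρ satLs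

  disj-preserved : ∀ {Γ} (M : Matrix Ω Γ) → (∀ {c} → c ∈ M → NegativesReflected c) →
                   Preserved (disjF Ω M)
  disj-preserved []            _         _  (lift ())
  disj-preserved (c ∷ [])      reflected    = conj-preserved c (reflected (here refl))
  disj-preserved (c ∷ c′ ∷ cs) reflected σρ (inj₁ satc) =
    inj₁ (conj-preserved c (reflected (here refl)) σρ satc)
  disj-preserved (c ∷ c′ ∷ cs) reflected σρ (inj₂ satcs) =
    inj₂ (disj-preserved (c′ ∷ cs) (λ i → reflected (there i)) σρ satcs)

  ∀-preserved : ∀ {Γ s} {φ : Formula Ω (s ∷ Γ)} → SurjectiveAt Ω H s →
                Preserved φ → Preserved (∀' s φ)
  ∀-preserved surj φ-preserved σρ satσ y with surj y
  ... | x , hx≈y = φ-preserved (extend-over σρ hx≈y) (satσ x)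

  ∃-preserved : ∀ {Γ s} {φ : Formula Ω (s ∷ Γ)} → Preserved φ → Preserved (∃' s φ)
  ∃-preserved φ-preserved σρ (x , satσ) =
    h x , φ-preserved (extend-over σρ ≈A.refl) satσ

  close-preserved : ∀ {Γ} (pre : Prefix Ω Γ) {φ : Formula Ω Γ} →
                    (∀ {s} → s ∈ univSorts Ω pre → SurjectiveAt Ω H s) →
                    Preserved φ → _⊨_ Ω B (close Ω pre φ) → _⊨_ Ω A (close Ω pre φ)
  close-preserved []                _    φ-preserved = φ-preserved (λ ())
  close-preserved (pre ▹ (all , s)) surj φ-preserved =
    close-preserved pre (λ i → surj (there i)) (∀-preserved (surj (here refl)) φ-preserved)
  close-preserved (pre ▹ (ex , s))  surj φ-preserved =
    close-preserved pre surj (∃-preserved φ-preserved)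

  prenexDNF-preserved : ∀ {Γ} (pre : Prefix Ω Γ) (M : Matrix Ω Γ) →
                        (∀ {s} → s ∈ univSorts Ω pre → SurjectiveAt Ω H s) →
                        (∀ {c} → c ∈ M → NegativesReflected c) →
                        _⊨_ Ω B (prenexDNF Ω pre M) → _⊨_ Ω A (prenexDNF Ω pre M)
  prenexDNF-preserved pre M surj reflected =
    close-preserved pre surj (disj-preserved M reflected)

-- That A is a model of S₀ only serves to guarantee that H exists; here H is given.
corollary1 : {a ℓ : Level} (Ω : Signature) (S₀ : Theory Ω)
    {Γ : List (Signature.Sort Ω)} (pre : Prefix Ω Γ) (M : Matrix Ω Γ)
    (A : Structure Ω a ℓ) → IsModel Ω A S₀ →
    (H : Hom Ω (Initial Ω (Closure Ω S₀)) A) →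
    (∀ {s} → s ∈ univSorts Ω pre → SurjectiveAt Ω H s) →
    (∀ {c} → c ∈ M → ∀ {α} → neg α ∈ c → Reflects Ω H α) →
    _⊨_ Ω A (¬' prenexDNF Ω pre M) →
    _⊨_ Ω (Initial Ω (Closure Ω S₀)) (¬' prenexDNF Ω pre M)
corollary1 Ω S₀ pre M A _ H surj reflected A⊭φ I⊨φ =
  A⊭φ (HomPreservation.prenexDNF-preserved H pre M surj reflected I⊨φ)
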